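{- The schema $!\textit{Sight-Preference}$, namely $[!\overline{s(h)}]\,\overline{h_1\geq h_2}\leftrightarrow(\overline{s(h)}\rightarrow\overline{h_1\geq h_2})$ for arbitrary histories $h,h_1,h_2$, is not valid in preference-sight models: there exist a preference-sight tree $(T,s)$ and histories $h,h_1,h_2$ such that this formula is not valid in the preference-sight model of $(T,s)$.
   Context: Preference trees: $T=(H,\succeq)$, $H$ a nonempty prefix-closed set of finite action sequences (histories) containing the empty sequence, $\succeq$ a total (complete, transitive) preference relation on $H$. $h\lhd h'$: $h$ is a prefix of $h'$ (reflexive); $H|_h$: histories extending $h$. A sight function assigns to each $h$ a nonempty finite $s(h)\subseteq H|_h$ with (DC) $h\lhd h'\lhd h''$, $h''\in s(h)\Rightarrow h'\in s(h)$ and (NF) $h\lhd h'\lhd h''$, $h''\in s(h)\Rightarrow h''\in s(h')$; $(T,s)$ is a preference-sight tree. Logic: atoms $\overline{h}$, $\overline{h_1\geq h_2}$, $\overline{s(h)}$ for histories; formulas $\varphi::=p\mid\neg\varphi\mid\varphi\wedge\psi\mid[!\varphi]\psi\mid A\varphi$. The preference-sight model is $M=(H,\lhd,\mathcal V)$ with $\mathcal V(\overline h)=\{h':h'\lhd h\}$, $\mathcal V(\overline{h_1\geq h_2})=H$ if $h_1\succeq h_2$ and $\emptyset$ otherwise, $\mathcal V(\overline{s(h)})=\bigcup_{h'\in s(h)}\mathcal V(\overline{h'})$. For $X\subseteq H$, $M_{!X}=(X,\lhd\cap X^2,\mathcal V_{!X})$ with $\mathcal V_{!X}(p)=\mathcal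 V(p)\cap X$ for atoms not of the form $\overline{h_1\geq h_2}$, and $\mathcal V_{!X}(\overline{h_1\geq h_2})=X$ if $\mathcal V(\overline{z_1\geq z_2})=H$ where $z_i$ is a $\succeq$-maximal element of $\{z\in Z_X:h_i\lhd z\}$ ($Z_X$: elements of $X$ with no proper extension in $X$), and $\emptyset$ otherwise. Semantics: Booleans standard; $A\varphi$ true iff $\varphi$ true at all worlds of the current model; $M,h\models[!\varphi]\psi$ iff ($M,h\models\varphi$ implies $M_{!\varphi},h\models\psi$), with $M_{!\varphi}=M_{!X}$ for $X$ the set of $\varphi$-worlds. Valid in $M$: true at all worlds. -}

module Defs where

open import Level using (Level; 0ℓ) renaming (suc to lsuc)
open import Data.List using (List; []; _∷_; _++_)
open import Data.List.Membership.Propositional using (_∈_)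
open import Data.Product using (Σ; ∃; _×_; _,_)
open import Data.Sum using (_⊎_)
open import Relation.Nullary using (¬_)
open import Relation.Binary.PropositionalEquality using (_≡_)

module _ {A : Set} where

  History : Set
  History = List A

  _⊲_ : History → History → Set
  h ⊲ h' = ∃ λ t → h ++ t ≡ h'

  record PSTree : Set₁ where
    field
      H        : History → Set
      H-nil    : H []
      H-prefix : ∀ {h h'} → h ⊲ h' → H h' → H h
      _≽_      : History → History → Set
      ≽-total  : ∀ {h h'} → H h → H h' → (h ≽ h') ⊎ (h' ≽ h)
      ≽-trans  : ∀ {h h' h''} → H h → H h' → H h'' → h ≽ h' → h' ≽ h'' → h ≽ h''
      s        : History → List History
      s-nonempty : ∀ {h} → H h → ∃ λ h' → h' ∈ s h
      s-ext    : ∀ {h h'} → H h → h' ∈ s h → H h' × h ⊲ h'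
      s-DC     : ∀ {h h' h''} → H h → h ⊲ h' → h' ⊲ h'' → h'' ∈ s h → h' ∈ s h
      s-NF     : ∀ {h h' h''} → H h → h ⊲ h' → h' ⊲ h'' → h'' ∈ s h → h'' ∈ s h'

  data Atom : Set where
    hist  : History → Atom
    geq   : History → History → Atom
    sight : History → Atom

  data Formula : Set where
    atom : Atom → Formula
    ¬'_  : Formula → Formula
    _∧'_ : Formula → Formula → Formula
    [!_]_ : Formula → Formula → Formula
    A'_  : Formula → Formula

  _→'_ : Formula → Formula → Formula
  φ →' ψ = ¬' (φ ∧' (¬' ψ))

  _↔'_ : Formula → Formula → Formula
  φ ↔' ψ = (φ →' ψ) ∧' (ψ →' φ)

  -- Models: a domain (set of worlds ⊆ histories, ordered by ⊲ restricted
  -- to the domain), a valuation, and the tree's preference ≽ (needed to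
  -- interpret ≥-atoms after an update).

  record Model : Set₁ where
    field
      dom  : History → Set
      val  : Atom → History → Set
      pref : History → History → Set

  open Model public

  Leaf : (History → Set) → History → Set
  Leaf X z = X z × (∀ z' → X z' → z ⊲ z' → z' ≡ z)

  MaxLeaf : (History → History → Set) → (History → Set) → History → History → Set
  MaxLeaf _≽_ X h z = (Leaf X z × h ⊲ z) × (∀ z' → Leaf X z' → h ⊲ z' → ¬ (z' ≽ z × ¬ (z ≽ z')))

  update : Model → (History → Set) → Model
  update M X = record
    { dom  = X
    ; val  = v
    ; pref = pref M
    }
    where
      v : Atom → History → Set
      v (geq h₁ h₂) w = X w × (∃ λ z₁ → ∃ λ z₂ → MaxLeaf (pref M) X h₁ z₁ × MaxLeaf (pref M) X h₂ z₂
                                 × (∀ u → dom M u → val M (geq z₁ z₂) u))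
      v a w = val M a w × X w

  _,_⊨_ : Model → History → Formula → Set
  M , w ⊨ atom p    = val M p w
  M , w ⊨ (¬' φ)    = ¬ (M , w ⊨ φ)
  M , w ⊨ (φ ∧' ψ)  = (M , w ⊨ φ) × (M , w ⊨ ψ)
  M , w ⊨ ([! φ ] ψ) = M , w ⊨ φ → update M (λ u → dom M u × (M , u ⊨ φ)) , w ⊨ ψ
  M , w ⊨ (A' φ)    = ∀ u → dom M u → M , u ⊨ φ

  Valid : Model → Formula → Set
  Valid M φ = ∀ w → dom M w → M , w ⊨ φ

  psModel : PSTree → Model
  psModel T = record
    { dom  = H
    ; val  = v
    ; pref = _≽_
    }
    where
      open PSTree T
      v : Atom → History → Set
      v (hist h)    w = w ⊲ h
      v (geq h₁ h₂) w = h₁ ≽ h₂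
      v (sight h)   w = ∃ λ h' → h' ∈ s h × w ⊲ h'

  sightPref : History → History → History → Formula
  sightPref h h₁ h₂ =
    ([! atom (sight h) ] atom (geq h₁ h₂)) ↔' (atom (sight h) →' atom (geq h₁ h₂))

-- Announcing the sight of h restricts the model to the histories seen from h,
-- and there an atom h₁ ≥ h₂ is re-read as a comparison of the best leaves
-- reachable from h₁ and from h₂.  With the myopic sight s(h) = {h} the only
-- leaf is h itself, so after the announcement every h₁ ≥ h₂ with h₁, h₂ ⊲ h
-- holds.  If longer histories are strictly preferred, [] ≥ [a] is false in the
-- original model, so at [] the announced form is true while the conditional
-- form is false.
module Submission where

open import Defs
open import Data.List using (List; []; _∷_; [_]; _++_; length)
open import Data.List.Properties using (++-identityʳ; ++-identityʳ-unique; ++-assoc; ++-conicalˡ)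
open import Data.List.Relation.Unary.Any using (here)
open import Data.Nat using (_≤_)
open import Data.Nat.Properties using (≤-total; ≤-trans)
open import Data.Product using (Σ; _×_; _,_; proj₁)
open import Data.Sum using (_⊎_; [_,_]′)
open import Data.Unit using (⊤; tt)
open import Function using (id)
open import Relation.Nullary using (¬_)
open import Relation.Binary.PropositionalEquality using (_≡_; refl; sym; trans)

module _ {A : Set} where

  ⊲-refl : (h : List A) → h ⊲ h
  ⊲-refl h = [] , ++-identityʳ h

  ⊲-antisym : ∀ {h h' : List A} → h ⊲ h' → h' ⊲ h → h ≡ h'
  ⊲-antisym {h} (t , refl) (t' , e)
    with ++-conicalˡ t t' (++-identityʳ-unique h (sym (trans (sym (++-assoc h t t')) e)))
  ... | refl = sym (++-identityʳ h)

  announce : Model {A} → Formula {A} → Model {A}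
  announce M φ = update M (λ u → dom M u × (M , u ⊨ φ))

  sightPref-refuted : (T : PSTree {A}) {h h₁ h₂ w : List A} → PSTree.H T w →
                      psModel T , w ⊨ atom (sight h) → ¬ PSTree._≽_ T h₁ h₂ →
                      announce (psModel T) (atom (sight h)) , w ⊨ atom (geq h₁ h₂) →
                      ¬ Valid (psModel T) (sightPref h h₁ h₂)
  sightPref-refuted T {w = w} Hw sees h₁⋡h₂ forced valid =
    proj₁ (valid w Hw) ((λ _ → forced) , λ conditional → conditional (sees , h₁⋡h₂))

module Myopic {A : Set} (_≽_ : List A → List A → Set)
              (≽-total : ∀ h h' → (h ≽ h') ⊎ (h' ≽ h))
              (≽-trans : ∀ {h h' h''} → h ≽ h' → h' ≽ h'' → h ≽ h'') where

  tree : PSTree {A}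
  tree = record
    { H          = λ _ → ⊤
    ; H-nil      = tt
    ; H-prefix   = λ _ _ → tt
    ; _≽_        = _≽_
    ; ≽-total    = λ {h} {h'} _ _ → ≽-total h h'
    ; ≽-trans    = λ _ _ _ → ≽-trans
    ; s          = [_]
    ; s-nonempty = λ {h} _ → h , here refl
    ; s-ext      = λ { {h} _ (here refl) → tt , ⊲-refl h }
    ; s-DC       = λ { _ h⊲h' h'⊲h (here refl) → here (sym (⊲-antisym h⊲h' h'⊲h)) }
    ; s-NF       = λ { _ h⊲h' h'⊲h (here refl) → here (⊲-antisym h⊲h' h'⊲h) }
    }

  seen : List A → List A → Set
  seen h u = ⊤ × psModel tree , u ⊨ atom (sight h)

  seen-only-leaf : ∀ {h z} → Leaf (seen h) z → z ≡ h
  seen-only-leaf {h} ((_ , _ , here refl , z⊲h) , maximal) =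
    sym (maximal h (tt , h , here refl , ⊲-refl h) z⊲h)

  seen-maxLeaf : ∀ {h h'} → h' ⊲ h → MaxLeaf _≽_ (seen h) h' h
  seen-maxLeaf {h} h'⊲h = (leaf , h'⊲h) , λ z' z'-leaf _ → not-strictly-better z' (seen-only-leaf z'-leaf)
    where
      leaf : Leaf (seen h) h
      leaf = (tt , h , here refl , ⊲-refl h) ,
             λ { z' (_ , _ , here refl , z'⊲h) h⊲z' → ⊲-antisym z'⊲h h⊲z' }

      not-strictly-better : ∀ z' → z' ≡ h → ¬ (z' ≽ h × ¬ (h ≽ z'))
      not-strictly-better _ refl (better , ¬better) = ¬better better

  ≽-refl : ∀ h → h ≽ h
  ≽-refl h = [ id , id ]′ (≽-total h h)

  announced-sight-forces-geq : ∀ {h h₁ h₂ w} → h₁ ⊲ h → h₂ ⊲ h → w ⊲ h →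
                               announce (psModel tree) (atom (sight h)) , w ⊨ atom (geq h₁ h₂)
  announced-sight-forces-geq {h} h₁⊲h h₂⊲h w⊲h =
    (tt , h , here refl , w⊲h) , h , h , seen-maxLeaf h₁⊲h , seen-maxLeaf h₂⊲h , λ _ _ → ≽-refl h

longer-preferred : List ⊤ → List ⊤ → Set
longer-preferred h h' = length h' ≤ length h

open Myopic longer-preferred (λ h h' → ≤-total (length h') (length h)) (λ p q → ≤-trans q p)

mainTheorem8 : Σ Set λ A → Σ (PSTree {A}) λ T →
                 Σ (List A) λ h → Σ (List A) λ h₁ → Σ (List A) λ h₂ →
                   PSTree.H T h × PSTree.H T h₁ × PSTree.H T h₂ ×
                   ¬ Valid (psModel T) (sightPref h h₁ h₂)
mainTheorem8 = ⊤ , tree , [ tt ] , [] , [ tt ] , tt , tt , tt ,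
  sightPref-refuted tree {w = []} tt ([ tt ] , here refl , [ tt ] , refl) (λ ())
    (announced-sight-forces-geq {w = []} ([ tt ] , refl) (⊲-refl [ tt ]) ([ tt ] , refl))
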